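{- Let $G$ and $H$ be finite graphs, let $D$ be a maximum-length legal sequence of $G\boxtimes H$, and let $v\in V(G)$. Let $F_v$ be the set of vertices of $D$ whose footprint (with respect to $D$) contains at least one vertex of $\{v\}\times V(H)$. Then $|F_v|\le\gamma_{gr}(H)$.
   Context: For a graph $G$, a sequence of vertices $S=(v_1,\dots,v_k)$ is a legal sequence if for every $i\in[k]$, $N[v_i]\setminus\bigcup_{j=1}^{i-1}N[v_j]\neq\emptyset$ ($N[v]$ the closed neighborhood); this set is the footprint of $v_i$. The Grundy domination number $\gamma_{gr}(G)$ is the maximum length of a legal sequence of $G$. The strong product $G\boxtimes H$ has vertex set $V(G)\times V(H)$, and $(g_1,h_1)$, $(g_2,h_2)$ are adjacent iff either $g_1=g_2$ and $h_1h_2\in E(H)$, or $g_1g_2\in E(G)$ and $h_1=h_2$, or $g_1g_2\in E(G)$ and $h_1h_2\in E(H)$. -}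

module Defs where

open import Data.Nat using (ℕ; zero; suc; _+_; _≤_)
open import Data.Fin using (Fin)
open import Data.Fin.Properties using () renaming (_≟_ to _≟ᶠ_)
open import Data.Bool using (Bool; true; false; _∧_; _∨_; not; T; if_then_else_)
open import Data.List using (List; []; _∷_; allFin; length)
open import Data.Bool.ListAction using (any)
open import Data.Product using (_×_; _,_; Σ; ∃)
open import Data.Product.Properties using (≡-dec)
open import Data.Unit using (⊤)
open import Relation.Nullary.Decidable using (⌊_⌋)
open import Relation.Binary.Definitions using (DecidableEquality)
open import Relation.Binary.PropositionalEquality using (_≡_)

record Graph : Set where
  field
    n      : ℕ
    adj    : Fin n → Fin n → Bool
    sym    : ∀ x y → adj x y ≡ adj y x
    irrefl : ∀ x → adj x x ≡ false
open Graph public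

module Legal {V : Set} (_≟_ : DecidableEquality V) (adjV : V → V → Bool) where

  closedN : V → V → Bool
  closedN x u = ⌊ x ≟ u ⌋ ∨ adjV x u

  covered : List V → V → Bool
  covered prev u = any (λ w → closedN w u) prev

  inFootprint : List V → V → V → Bool
  inFootprint prev x u = closedN x u ∧ not (covered prev u)

  LegalFrom : List V → List V → Set
  LegalFrom prev []       = ⊤
  LegalFrom prev (x ∷ xs) = (∃ λ u → T (inFootprint prev x u)) × LegalFrom (x ∷ prev) xs

  IsLegal : List V → Set
  IsLegal = LegalFrom []

  IsMaxLegal : List V → Set
  IsMaxLegal D = IsLegal D × (∀ D' → IsLegal D' → length D' ≤ length D)

  IsGrundyDomNumber : ℕ → Set
  IsGrundyDomNumber k = (∃ λ S → IsLegal S × length S ≡ k) × (∀ S → IsLegal S → length S ≤ k)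

module _ (G : Graph) where
  open Graph G renaming (n to nG; adj to adjG)
  γgr-is : ℕ → Set
  γgr-is = Legal.IsGrundyDomNumber (_≟ᶠ_ {nG}) adjG

  IsLegalG : List (Fin nG) → Set
  IsLegalG = Legal.IsLegal (_≟ᶠ_ {nG}) adjG

module Strong (G H : Graph) where
  Vtx : Set
  Vtx = Fin (n G) × Fin (n H)

  _≟ᵥ_ : DecidableEquality Vtx
  _≟ᵥ_ = ≡-dec _≟ᶠ_ _≟ᶠ_

  adj⊠ : Vtx → Vtx → Bool
  adj⊠ (g₁ , h₁) (g₂ , h₂) =
       (⌊ g₁ ≟ᶠ g₂ ⌋ ∧ adj H h₁ h₂)
    ∨ (adj G g₁ g₂ ∧ ⌊ h₁ ≟ᶠ h₂ ⌋)
    ∨ (adj G g₁ g₂ ∧ adj H h₁ h₂)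

  open Legal _≟ᵥ_ adj⊠ public

  footMeetsLayer : Fin (n G) → List Vtx → Vtx → Bool
  footMeetsLayer v prev x = any (λ h → inFootprint prev x (v , h)) (allFin (n H))

  countFrom : Fin (n G) → List Vtx → List Vtx → ℕ
  countFrom v prev []       = 0
  countFrom v prev (x ∷ xs) =
    (if footMeetsLayer v prev x then 1 else 0) + countFrom v (x ∷ prev) xs

  |F| : Fin (n G) → List Vtx → ℕ
  |F| v D = countFrom v [] D

-- Project D onto the second coordinate, keeping only the entries whose footprint meets the
-- layer {v} × V(H).  Since N[(g, k)] = N[g] × N[k], an entry (g, k) whose footprint contains
-- (v, h) has g ∈ N[v] and h ∈ N[k]; and every h covered by the projected H-sequence so far has
-- (v, h) covered by D so far.  Hence h lies in the H-footprint of k, the projection is a legal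
-- sequence of H, and its length |F_v| is at most γ_gr(H).
module Submission where

open import Defs hiding (sym)
open import Data.Nat using (ℕ; _≤_; suc)
open import Data.Fin using (Fin)
open import Data.Fin.Properties using () renaming (_≟_ to _≟ᶠ_)
open import Data.List using (List; []; _∷_; length; allFin)
open import Data.List.Relation.Unary.Any using (satisfied)
open import Data.List.Relation.Unary.Any.Properties using (any⁻)
open import Data.Bool using (Bool; true; false; _∧_; _∨_; not; T)
open import Data.Bool.Properties using (T-∧; T-∨; T-not-≡; T-≡)
open import Data.Product using (_×_; _,_; proj₁; proj₂)
open import Data.Sum using (_⊎_; [_,_]; inj₁; inj₂)
open import Data.Unit using (tt)
open import Relation.Nullary.Decidable using (⌊_⌋; does; _×-dec_; isYes≗does; does-⇔)
open import Relation.Binary.Definitions using (DecidableEquality)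
open import Relation.Binary.PropositionalEquality
  using (_≡_; refl; subst; cong; cong₂; sym; module ≡-Reasoning)
open import Data.Product.Properties using (×-≡,≡→≡; ×-≡,≡←≡)
open import Function.Bundles using (Equivalence; _⇔_; mk⇔)
open Equivalence using (to; from)

∧-∨-expand : ∀ d e a b →
  (d ∧ e) ∨ ((d ∧ b) ∨ (a ∧ e) ∨ (a ∧ b)) ≡ (d ∨ a) ∧ (e ∨ b)
∧-∨-expand true  true  true  true  = refl
∧-∨-expand true  true  true  false = refl
∧-∨-expand true  true  false true  = refl
∧-∨-expand true  true  false false = refl
∧-∨-expand true  false true  true  = refl
∧-∨-expand true  false true  false = refl
∧-∨-expand true  false false true  = refl
∧-∨-expand true  false false false = refl
∧-∨-expand false true  true  true  = refl
∧-∨-expand false true  true  false = refl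
∧-∨-expand false true  false true  = refl
∧-∨-expand false true  false false = refl
∧-∨-expand false false true  true  = refl
∧-∨-expand false false true  false = refl
∧-∨-expand false false false true  = refl
∧-∨-expand false false false false = refl

module _ {V : Set} (_≟_ : DecidableEquality V) (adjV : V → V → Bool) where
  open Legal _≟_ adjV

  covered-∷ : ∀ x prev u →
    T (covered (x ∷ prev) u) ⇔ (T (closedN x u) ⊎ T (covered prev u))
  covered-∷ x prev u = T-∨

module _ (G H : Graph) where
  open Strong G H
  module LG = Legal (_≟ᶠ_ {n G}) (adj G)
  module LH = Legal (_≟ᶠ_ {n H}) (adj H)

  ≟ᵥ-pairwise : ∀ g k v h → ⌊ (g , k) ≟ᵥ (v , h) ⌋ ≡ ⌊ g ≟ᶠ v ⌋ ∧ ⌊ k ≟ᶠ h ⌋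
  ≟ᵥ-pairwise g k v h = begin
    ⌊ (g , k) ≟ᵥ (v , h) ⌋
      ≡⟨ isYes≗does ((g , k) ≟ᵥ (v , h)) ⟩
    does ((g , k) ≟ᵥ (v , h))
      ≡⟨ does-⇔ (mk⇔ ×-≡,≡←≡ ×-≡,≡→≡) ((g , k) ≟ᵥ (v , h)) (g ≟ᶠ v ×-dec k ≟ᶠ h) ⟩
    does (g ≟ᶠ v) ∧ does (k ≟ᶠ h)
      ≡⟨ sym (cong₂ _∧_ (isYes≗does (g ≟ᶠ v)) (isYes≗does (k ≟ᶠ h))) ⟩
    ⌊ g ≟ᶠ v ⌋ ∧ ⌊ k ≟ᶠ h ⌋
      ∎
    where open ≡-Reasoning

  closedN-⊠ : ∀ g k v h → closedN (g , k) (v , h) ≡ LG.closedN g v ∧ LH.closedN k h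
  closedN-⊠ g k v h rewrite ≟ᵥ-pairwise g k v h =
    ∧-∨-expand ⌊ g ≟ᶠ v ⌋ ⌊ k ≟ᶠ h ⌋ (adj G g v) (adj H k h)

  closedN-⊠⇔ : ∀ g k v h →
    T (closedN (g , k) (v , h)) ⇔ (T (LG.closedN g v) × T (LH.closedN k h))
  closedN-⊠⇔ g k v h rewrite closedN-⊠ g k v h = T-∧

  module _ (v : Fin (n G)) where

    layerTrace : List Vtx → List Vtx → List (Fin (n H))
    layerTrace prev []             = []
    layerTrace prev ((g , k) ∷ xs) with footMeetsLayer v prev (g , k)
    ... | true  = k ∷ layerTrace ((g , k) ∷ prev) xs
    ... | false = layerTrace ((g , k) ∷ prev) xs

    length-layerTrace : ∀ prev xs → length (layerTrace prev xs) ≡ countFrom v prev xs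
    length-layerTrace prev []             = refl
    length-layerTrace prev ((g , k) ∷ xs) with footMeetsLayer v prev (g , k)
    ... | true  = cong suc (length-layerTrace ((g , k) ∷ prev) xs)
    ... | false = length-layerTrace ((g , k) ∷ prev) xs

    LayerCovers : List Vtx → List (Fin (n H)) → Set
    LayerCovers prev P = ∀ h → T (LH.covered P h) → T (covered prev (v , h))

    inFootprint-projects : ∀ prev P {g k h} → LayerCovers prev P →
      T (inFootprint prev (g , k) (v , h)) → T (LH.inFootprint P k h)
    inFootprint-projects prev P {g} {k} {h} covers fp =
      from T-∧ (proj₂ (to (closedN-⊠⇔ g k v h) (proj₁ (to T-∧ fp))) , notCoveredH)
      where
      notCoveredH : T (not (LH.covered P h))
      notCoveredH with LH.covered P h in eq
      ... | false = tt
      ... | true  = subst T (to T-not-≡ (proj₂ (to T-∧ fp))) (covers h (from T-≡ eq))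

    layerCovers-∷ : ∀ prev P {g k} → LayerCovers prev P → T (LG.closedN g v) →
      LayerCovers ((g , k) ∷ prev) (k ∷ P)
    layerCovers-∷ prev P {g} {k} covers gv h covered =
      from (covered-∷ _≟ᵥ_ adj⊠ (g , k) prev (v , h))
        ([ (λ kh → inj₁ (from (closedN-⊠⇔ g k v h) (gv , kh)))
         , (λ c → inj₂ (covers h c)) ] (to (covered-∷ _≟ᶠ_ (adj H) k P h) covered))

    layerCovers-skip : ∀ prev P x → LayerCovers prev P → LayerCovers (x ∷ prev) P
    layerCovers-skip prev P x covers h c =
      from (covered-∷ _≟ᵥ_ adj⊠ x prev (v , h)) (inj₂ (covers h c))

    layerTrace-legal : ∀ prev P xs → LayerCovers prev P → LH.LegalFrom P (layerTrace prev xs)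
    layerTrace-legal prev P []             covers = tt
    layerTrace-legal prev P ((g , k) ∷ xs) covers
      with footMeetsLayer v prev (g , k) in meets
    ... | false = layerTrace-legal ((g , k) ∷ prev) P xs (layerCovers-skip prev P (g , k) covers)
    ... | true  with (h , fp) ← satisfied (any⁻ _ (allFin (n H)) (from T-≡ meets)) =
      (h , inFootprint-projects prev P {g} covers fp) ,
      layerTrace-legal ((g , k) ∷ prev) (k ∷ P) xs (layerCovers-∷ prev P covers gv)
      where
      gv : T (LG.closedN g v)
      gv = proj₁ (to (closedN-⊠⇔ g k v h) (proj₁ (to T-∧ fp)))

lemma4p1 : (G H : Graph) (D : List (Strong.Vtx G H)) → Strong.IsMaxLegal G H D →
    (v : Fin (Graph.n G)) (k : ℕ) → γgr-is H k → Strong.|F| G H v D ≤ k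
lemma4p1 G H D _ v k (_ , maximal) =
  subst (_≤ k) (length-layerTrace G H v [] D)
    (maximal (layerTrace G H v [] D) (layerTrace-legal G H v [] [] D (λ _ ())))
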